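{- Let $n$ be any positive integer. Then, as polynomial identities in $x$, $$\sum_{k=0}^{n-1}s_k(x)\sum_{j=0}^{n-1}\binom xj\binom{ -1-x}j\binom{k+j}j=\sum_{i=0}^{n-1}\sum_{j=0}^{n-1}\binom xi\binom{x+i}i\binom xj\binom{x+j}j\binom{n-1}i\binom{ -n-1}j\frac n{i+j+1}$$ and $$\frac1n\sum_{k=0}^{n-1}(2k+1)s_k(x)\sum_{j=0}^{n-1}\binom xj\binom{ -1-x}j\binom{k+j}j=\sum_{i=0}^{n-1}\sum_{j=0}^{n-1}\binom xi\binom{x+i}i\binom xj\binom{x+j}j\binom{n-1}i\binom{ -n-1}j\left(\frac{2n}{i+j+2}+\frac{i-j}{(i+j+1)(i+j+2)}\right).$$
   Context: For $n\in\{0,1,2,\ldots\}$, $s_n(x)=\sum_{k=0}^n\binom nk\binom xk\binom{x+k}k$, where $\binom xk=x(x-1)\cdots(x-k+1)/k!$. -}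

module Defs where

open import Data.Nat using (ℕ; zero; suc) renaming (_+_ to _+ℕ_; _*_ to _*ℕ_)
open import Data.Integer using (+_; -[1+_])
open import Data.Rational using (ℚ; _+_; _*_; _-_; _/_; 0ℚ; 1ℚ)

ℕ→ℚ : ℕ → ℚ
ℕ→ℚ n = + n / 1

binom : ℚ → ℕ → ℚ
binom x zero    = 1ℚ
binom x (suc k) = binom x k * ((x - ℕ→ℚ k) * (+ 1 / suc k))

Σ< : ℕ → (ℕ → ℚ) → ℚ
Σ< zero    f = 0ℚ
Σ< (suc n) f = Σ< n f + f n

s : ℕ → ℚ → ℚ
s n x = Σ< (suc n) (λ k → binom (ℕ→ℚ n) k * binom x k * binom (x + ℕ→ℚ k) k)

inner : ℕ → ℚ → ℕ → ℚ
inner n x k = Σ< n (λ j → binom x j * binom (-[1+ 0 ] / 1 - x) j * binom (ℕ→ℚ (k +ℕ j)) j)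

common : ℕ → ℚ → ℕ → ℕ → ℚ
common n x i j =
  binom x i * binom (x + ℕ→ℚ i) i * binom x j * binom (x + ℕ→ℚ j) j
  * binom (ℕ→ℚ n - 1ℚ) i * binom (-[1+ n ] / 1) j

module Submission where

-- Both identities are proved by expanding the left-hand side and summing
-- over k first.  For k < n the definition of s_k may be extended to
-- s_k(x) = Σ_{i<n} C(k,i) C(x,i) C(x+i,i), since C(k,i) = 0 for k < i, so
--
--   Σ_k w(k) s_k(x) inner(n,x,k)
--     = Σ_{i,j<n} C(x,i)C(x+i,i)C(x,j)C(-1-x,j) · Σ_{k<n} w(k) C(k,i) C(k+j,j).
--
-- The inner k-sums have closed forms, both proved by telescoping:
--   (i+j+1)         Σ_{k<n}        C(k,i)C(k+j,j) = n C(n-1,i) C(n+j,j),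
--   (i+j+1)(i+j+2)  Σ_{k<n} (2k+1) C(k,i)C(k+j,j) = n C(n-1,i) C(n+j,j) (2n(i+j+1) + i - j).
-- Finally the reflection formula C(-1-y,j) = (-1)^j C(y+j,j), used for y = x and
-- y = n, turns C(-1-x,j)C(n+j,j) into C(x+j,j)C(-n-1,j), the common factor on the right.

open import Defs
open import Data.Nat using (ℕ; zero; suc; NonZero; _∸_; _<_) renaming (_+_ to _+ℕ_; _*_ to _*ℕ_)
import Data.Nat.Properties as ℕ
open import Data.Integer as ℤ using (+_; -[1+_])
import Data.Integer.Properties as ℤₚ
open import Data.Rational using (ℚ; _+_; _*_; _-_; -_; _/_; 0ℚ; 1ℚ; fromℚᵘ)
open import Data.Rational.Properties
  using (fromℚᵘ-cong; toℚᵘ-injective; toℚᵘ-fromℚᵘ; toℚᵘ-homo-+; toℚᵘ-homo-*;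
         *-identityˡ; *-identityʳ; *-assoc; *-zeroʳ; *-comm; *-distribˡ-+; *-distribʳ-+; +-identityʳ)
import Data.Rational.Unnormalised as ℚᵘ
import Data.Rational.Unnormalised.Properties as ℚᵘ
open import Data.Rational.Solver using (module +-*-Solver)
open +-*-Solver
open import Data.Product using (_×_; _,_)
open import Relation.Binary.PropositionalEquality hiding (J)
open ≡-Reasoning

fromℚᵘ-+ : ∀ p q → fromℚᵘ (p ℚᵘ.+ q) ≡ fromℚᵘ p + fromℚᵘ q
fromℚᵘ-+ p q = toℚᵘ-injective (ℚᵘ.≃-trans (toℚᵘ-fromℚᵘ _)
  (ℚᵘ.≃-sym (ℚᵘ.≃-trans (toℚᵘ-homo-+ (fromℚᵘ p) (fromℚᵘ q))
                        (ℚᵘ.+-cong (toℚᵘ-fromℚᵘ p) (toℚᵘ-fromℚᵘ q)))))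

fromℚᵘ-* : ∀ p q → fromℚᵘ (p ℚᵘ.* q) ≡ fromℚᵘ p * fromℚᵘ q
fromℚᵘ-* p q = toℚᵘ-injective (ℚᵘ.≃-trans (toℚᵘ-fromℚᵘ _)
  (ℚᵘ.≃-sym (ℚᵘ.≃-trans (toℚᵘ-homo-* (fromℚᵘ p) (fromℚᵘ q))
                        (ℚᵘ.*-cong (toℚᵘ-fromℚᵘ p) (toℚᵘ-fromℚᵘ q)))))

ℕ→ℚ-+ : ∀ m n → ℕ→ℚ (m +ℕ n) ≡ ℕ→ℚ m + ℕ→ℚ n
ℕ→ℚ-+ m n = trans
  (fromℚᵘ-cong {ℚᵘ.mkℚᵘ (+ (m +ℕ n)) 0} {ℚᵘ.mkℚᵘ (+ m) 0 ℚᵘ.+ ℚᵘ.mkℚᵘ (+ n) 0} (ℚᵘ.*≡* cross))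
  (fromℚᵘ-+ (ℚᵘ.mkℚᵘ (+ m) 0) (ℚᵘ.mkℚᵘ (+ n) 0))
  where
  cross : + (m +ℕ n) ℤ.* + 1 ≡ (+ m ℤ.* + 1 ℤ.+ + n ℤ.* + 1) ℤ.* + 1
  cross = begin
    + (m +ℕ n) ℤ.* + 1                    ≡⟨ ℤₚ.*-identityʳ _ ⟩
    + (m +ℕ n)                            ≡⟨ ℤₚ.pos-+ m n ⟩
    + m ℤ.+ + n                           ≡⟨ sym (cong₂ ℤ._+_ (ℤₚ.*-identityʳ (+ m)) (ℤₚ.*-identityʳ (+ n))) ⟩
    + m ℤ.* + 1 ℤ.+ + n ℤ.* + 1           ≡⟨ sym (ℤₚ.*-identityʳ _) ⟩
    (+ m ℤ.* + 1 ℤ.+ + n ℤ.* + 1) ℤ.* + 1 ∎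

ℕ→ℚ-suc : ∀ n → ℕ→ℚ (suc n) ≡ 1ℚ + ℕ→ℚ n
ℕ→ℚ-suc = ℕ→ℚ-+ 1

ℕ→ℚ-2* : ∀ n → ℕ→ℚ (2 *ℕ n) ≡ ℕ→ℚ n + ℕ→ℚ n
ℕ→ℚ-2* n = trans (ℕ→ℚ-+ n (n +ℕ 0)) (cong (λ t → ℕ→ℚ n + t) (cong ℕ→ℚ (ℕ.+-identityʳ n)))

ℕ→ℚ-negsuc : ∀ n → -[1+ n ] / 1 ≡ - 1ℚ - ℕ→ℚ n
ℕ→ℚ-negsuc n = trans (cong -_ (ℕ→ℚ-suc n)) (solve 1 (λ N → :- (con 1ℚ :+ N) := :- con 1ℚ :- N) refl (ℕ→ℚ n))

recip : ℕ → ℚ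
recip b = + 1 / suc b

recip-inverse : ∀ b → ℕ→ℚ (suc b) * recip b ≡ 1ℚ
recip-inverse b = trans (*-comm (ℕ→ℚ (suc b)) (recip b))
  (trans (sym (fromℚᵘ-* (ℚᵘ.mkℚᵘ (+ 1) b) (ℚᵘ.mkℚᵘ (+ suc b) 0)))
         (fromℚᵘ-cong {ℚᵘ.mkℚᵘ (+ 1) b ℚᵘ.* ℚᵘ.mkℚᵘ (+ suc b) 0} {ℚᵘ.mkℚᵘ (+ 1) 0}
                      (ℚᵘ.*≡* (ℤₚ.*-assoc (+ 1) (+ suc b) (+ 1)))))

divide : ∀ {a b c d : ℚ} → a * c ≡ b → c * d ≡ 1ℚ → a ≡ b * d
divide {a} {b} {c} {d} ac≡b cd≡1 = begin
  a           ≡⟨ sym (*-identityʳ a) ⟩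
  a * 1ℚ      ≡⟨ cong (a *_) (sym cd≡1) ⟩
  a * (c * d) ≡⟨ sym (*-assoc a c d) ⟩
  (a * c) * d ≡⟨ cong (_* d) ac≡b ⟩
  b * d       ∎

/suc≡*recip : ∀ a b → + a / suc b ≡ ℕ→ℚ a * recip b
/suc≡*recip a b = trans
  (fromℚᵘ-cong {ℚᵘ.mkℚᵘ (+ a) b} {ℚᵘ.mkℚᵘ (+ a) 0 ℚᵘ.* ℚᵘ.mkℚᵘ (+ 1) b} (ℚᵘ.*≡* (sym (ℤₚ.*-assoc (+ a) (+ 1) (+ suc b)))))
  (fromℚᵘ-* (ℚᵘ.mkℚᵘ (+ a) 0) (ℚᵘ.mkℚᵘ (+ 1) b))

recip-* : ∀ a b → + 1 / (suc a *ℕ suc b) ≡ recip a * recip b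
recip-* a b = fromℚᵘ-* (ℚᵘ.mkℚᵘ (+ 1) a) (ℚᵘ.mkℚᵘ (+ 1) b)

Σ-cong : ∀ n {f g : ℕ → ℚ} → (∀ k → f k ≡ g k) → Σ< n f ≡ Σ< n g
Σ-cong zero    f≡g = refl
Σ-cong (suc n) f≡g = cong₂ _+_ (Σ-cong n f≡g) (f≡g n)

Σ-cong< : ∀ n {f g : ℕ → ℚ} → (∀ k → k < n → f k ≡ g k) → Σ< n f ≡ Σ< n g
Σ-cong< zero    f≡g = refl
Σ-cong< (suc n) f≡g =
  cong₂ _+_ (Σ-cong< n (λ k k<n → f≡g k (ℕ.m<n⇒m<1+n k<n))) (f≡g n ℕ.≤-refl)

Σ-zero : ∀ n → Σ< n (λ _ → 0ℚ) ≡ 0ℚ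
Σ-zero zero    = refl
Σ-zero (suc n) = cong (_+ 0ℚ) (Σ-zero n)

Σ-+ : ∀ n (f g : ℕ → ℚ) → Σ< n (λ k → f k + g k) ≡ Σ< n f + Σ< n g
Σ-+ zero    f g = refl
Σ-+ (suc n) f g = trans (cong (_+ (f n + g n)) (Σ-+ n f g))
  (solve 4 (λ a b c d → (a :+ b) :+ (c :+ d) := (a :+ c) :+ (b :+ d)) refl (Σ< n f) (Σ< n g) (f n) (g n))

Σ-*ˡ : ∀ n c (f : ℕ → ℚ) → c * Σ< n f ≡ Σ< n (λ k → c * f k)
Σ-*ˡ zero    c f = *-zeroʳ c
Σ-*ˡ (suc n) c f = trans (*-distribˡ-+ c (Σ< n f) (f n)) (cong (_+ c * f n) (Σ-*ˡ n c f))

Σ-*ʳ : ∀ n c (f : ℕ → ℚ) → Σ< n f * c ≡ Σ< n (λ k → f k * c)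
Σ-*ʳ n c f = trans (*-comm (Σ< n f) c) (trans (Σ-*ˡ n c f) (Σ-cong n (λ k → *-comm c (f k))))

Σ-swap : ∀ n m (F : ℕ → ℕ → ℚ) →
         Σ< n (λ k → Σ< m (F k)) ≡ Σ< m (λ i → Σ< n (λ k → F k i))
Σ-swap zero    m F = sym (Σ-zero m)
Σ-swap (suc n) m F = trans (cong (_+ Σ< m (F n)) (Σ-swap n m F))
  (sym (Σ-+ m (λ i → Σ< n (λ k → F k i)) (F n)))

Σ-product : ∀ n m (f g : ℕ → ℚ) → Σ< n f * Σ< m g ≡ Σ< n (λ i → Σ< m (λ j → f i * g j))
Σ-product n m f g = trans (Σ-*ʳ n (Σ< m g) f) (Σ-cong n (λ i → Σ-*ˡ m (f i) g))

Σ-extend : ∀ m d (f : ℕ → ℚ) → (∀ e → f (e +ℕ m) ≡ 0ℚ) → Σ< (d +ℕ m) f ≡ Σ< m f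
Σ-extend m zero    f vanish = refl
Σ-extend m (suc d) f vanish =
  trans (cong₂ _+_ (Σ-extend m d f vanish) (vanish d)) (+-identityʳ (Σ< m f))

binom-absorb : ∀ y j → (y + 1ℚ) * binom y j ≡ (y + 1ℚ - ℕ→ℚ j) * binom (y + 1ℚ) j
binom-absorb y zero =
  solve 1 (λ y → (y :+ con 1ℚ) :* con 1ℚ := (y :+ con 1ℚ :- con 0ℚ) :* con 1ℚ) refl y
binom-absorb y (suc j) = begin
  (y + 1ℚ) * (binom y j * ((y - J) * recip j))
    ≡⟨ solve 4 (λ y b J R → (y :+ con 1ℚ) :* (b :* ((y :- J) :* R)) := ((y :+ con 1ℚ) :* b) :* ((y :- J) :* R))
         refl y (binom y j) J (recip j) ⟩
  ((y + 1ℚ) * binom y j) * ((y - J) * recip j)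
    ≡⟨ cong (_* ((y - J) * recip j)) (binom-absorb y j) ⟩
  ((y + 1ℚ - J) * binom (y + 1ℚ) j) * ((y - J) * recip j)
    ≡⟨ solve 4 (λ y b J R → ((y :+ con 1ℚ :- J) :* b) :* ((y :- J) :* R)
                          := (y :+ con 1ℚ :- (con 1ℚ :+ J)) :* (b :* ((y :+ con 1ℚ :- J) :* R)))
         refl y (binom (y + 1ℚ) j) J (recip j) ⟩
  (y + 1ℚ - (1ℚ + J)) * binom (y + 1ℚ) (suc j)
    ≡⟨ cong (λ t → (y + 1ℚ - t) * binom (y + 1ℚ) (suc j)) (sym (ℕ→ℚ-suc j)) ⟩
  (y + 1ℚ - ℕ→ℚ (suc j)) * binom (y + 1ℚ) (suc j) ∎
  where
  J : ℚ
  J = ℕ→ℚ j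

binom-suc-absorb : ∀ a j → binom (a + 1ℚ) (suc j) ≡ (a + 1ℚ) * recip j * binom a j
binom-suc-absorb a zero =
  solve 2 (λ a R → con 1ℚ :* ((a :+ con 1ℚ :- con 0ℚ) :* R) := (a :+ con 1ℚ) :* R :* con 1ℚ) refl a (recip 0)
binom-suc-absorb a (suc j) = begin
  binom (a + 1ℚ) (suc j) * ((a + 1ℚ - ℕ→ℚ (suc j)) * recip (suc j))
    ≡⟨ cong₂ (λ u v → u * ((a + 1ℚ - v) * recip (suc j))) (binom-suc-absorb a j) (ℕ→ℚ-suc j) ⟩
  ((a + 1ℚ) * recip j * binom a j) * ((a + 1ℚ - (1ℚ + J)) * recip (suc j))
    ≡⟨ solve 5 (λ a R b J R' → ((a :+ con 1ℚ) :* R :* b) :* ((a :+ con 1ℚ :- (con 1ℚ :+ J)) :* R')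
                             := (a :+ con 1ℚ) :* R' :* (b :* ((a :- J) :* R)))
         refl a (recip j) (binom a j) J (recip (suc j)) ⟩
  (a + 1ℚ) * recip (suc j) * binom a (suc j) ∎
  where
  J : ℚ
  J = ℕ→ℚ j

sign : ℕ → ℚ
sign zero    = 1ℚ
sign (suc j) = - sign j

binom-reflect : ∀ y j → binom (- 1ℚ - y) j ≡ sign j * binom (y + ℕ→ℚ j) j
binom-reflect y zero = solve 0 (con 1ℚ := con 1ℚ :* con 1ℚ) refl
binom-reflect y (suc j) = begin
  binom (- 1ℚ - y) j * ((- 1ℚ - y - J) * recip j)
    ≡⟨ cong (_* ((- 1ℚ - y - J) * recip j)) (binom-reflect y j) ⟩
  sign j * binom (y + J) j * ((- 1ℚ - y - J) * recip j)
    ≡⟨ solve 5 (λ s b y J R → s :* b :* ((:- con 1ℚ :- y :- J) :* R) := (:- s) :* ((y :+ J :+ con 1ℚ) :* R :* b))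
         refl (sign j) (binom (y + J) j) y J (recip j) ⟩
  - sign j * ((y + J + 1ℚ) * recip j * binom (y + J) j)
    ≡⟨ cong (- sign j *_) (sym (binom-suc-absorb (y + J) j)) ⟩
  - sign j * binom (y + J + 1ℚ) (suc j)
    ≡⟨ cong (λ t → - sign j * binom t (suc j)) y+J+1≡y+[j+1] ⟩
  - sign j * binom (y + ℕ→ℚ (suc j)) (suc j) ∎
  where
  J : ℚ
  J = ℕ→ℚ j
  y+J+1≡y+[j+1] : y + J + 1ℚ ≡ y + ℕ→ℚ (suc j)
  y+J+1≡y+[j+1] = trans (solve 2 (λ y J → y :+ J :+ con 1ℚ := y :+ (con 1ℚ :+ J)) refl y J)
                        (cong (λ t → y + t) (sym (ℕ→ℚ-suc j)))

binom-reflect-swap : ∀ y z j → binom (- 1ℚ - y) j * binom (z + ℕ→ℚ j) j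
                             ≡ binom (y + ℕ→ℚ j) j * binom (- 1ℚ - z) j
binom-reflect-swap y z j = begin
  binom (- 1ℚ - y) j * Z          ≡⟨ cong (_* Z) (binom-reflect y j) ⟩
  sign j * Y * Z                  ≡⟨ solve 3 (λ s a b → s :* a :* b := a :* (s :* b)) refl (sign j) Y Z ⟩
  Y * (sign j * Z)                ≡⟨ cong (Y *_) (sym (binom-reflect z j)) ⟩
  Y * binom (- 1ℚ - z) j          ∎
  where
  Y Z : ℚ
  Y = binom (y + ℕ→ℚ j) j
  Z = binom (z + ℕ→ℚ j) j

binom-vanish : ∀ k e → binom (ℕ→ℚ k) (e +ℕ suc k) ≡ 0ℚ
binom-vanish k zero =
  solve 3 (λ b K R → b :* ((K :- K) :* R) := con 0ℚ) refl (binom (ℕ→ℚ k) k) (ℕ→ℚ k) (recip k)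
binom-vanish k (suc e) = begin
  binom (ℕ→ℚ k) (e +ℕ suc k) * step ≡⟨ cong (_* step) (binom-vanish k e) ⟩
  0ℚ * step                          ≡⟨ solve 1 (λ u → con 0ℚ :* u := con 0ℚ) refl step ⟩
  0ℚ                                 ∎
  where
  step : ℚ
  step = (ℕ→ℚ k - ℕ→ℚ (e +ℕ suc k)) * recip (e +ℕ suc k)

odd : ℕ → ℚ
odd k = ℕ→ℚ (2 *ℕ k +ℕ 1)

odd≡ : ∀ k → odd k ≡ ℕ→ℚ k + ℕ→ℚ k + 1ℚ
odd≡ k = trans (ℕ→ℚ-+ (2 *ℕ k) 1) (cong (_+ 1ℚ) (ℕ→ℚ-2* k))

module KSum (i j : ℕ) where

  I J : ℚ
  I = ℕ→ℚ i
  J = ℕ→ℚ j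

  kernel : ℕ → ℚ
  kernel k = binom (ℕ→ℚ k) i * binom (ℕ→ℚ (k +ℕ j)) j

  -- G(n) = n C(n-1,i) C(n+j,j); by antidiff≡ and antidiff-suc its forward difference
  -- is (i+j+1) c(n), so G is an antidifference of (i+j+1) c.
  antidiff : ℕ → ℚ
  antidiff n = ℕ→ℚ n * binom (ℕ→ℚ n - 1ℚ) i * binom (ℕ→ℚ (n +ℕ j)) j

  linear : ℕ → ℚ
  linear n = ℕ→ℚ (2 *ℕ n) * ℕ→ℚ (suc (i +ℕ j)) + (I - J)

  [i+j+1]≡ : ℕ→ℚ (suc (i +ℕ j)) ≡ 1ℚ + (I + J)
  [i+j+1]≡ = trans (ℕ→ℚ-suc (i +ℕ j)) (cong (λ t → 1ℚ + t) (ℕ→ℚ-+ i j))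

  [i+j+2]≡ : ℕ→ℚ (suc (suc (i +ℕ j))) ≡ 1ℚ + (1ℚ + (I + J))
  [i+j+2]≡ = trans (ℕ→ℚ-suc (suc (i +ℕ j))) (cong (λ t → 1ℚ + t) [i+j+1]≡)

  linear≡ : ∀ n → linear n ≡ (ℕ→ℚ n + ℕ→ℚ n) * (1ℚ + (I + J)) + (I - J)
  linear≡ n = cong₂ (λ u v → u * v + (I - J)) (ℕ→ℚ-2* n) [i+j+1]≡

  -- G(n) = (n - i) c(n), by absorption in the upper argument n-1 of C(n-1,i).
  antidiff≡ : ∀ n → antidiff n ≡ (ℕ→ℚ n - I) * kernel n
  antidiff≡ n = begin
    N * C[n-1] * Q
      ≡⟨ cong (_* Q) (solve 2 (λ N b → N :* b := (N :- con 1ℚ :+ con 1ℚ) :* b) refl N C[n-1]) ⟩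
    (N - 1ℚ + 1ℚ) * C[n-1] * Q
      ≡⟨ cong (_* Q) (binom-absorb (N - 1ℚ) i) ⟩
    (N - 1ℚ + 1ℚ - I) * binom (N - 1ℚ + 1ℚ) i * Q
      ≡⟨ cong (λ t → (t - I) * binom t i * Q) (solve 1 (λ N → N :- con 1ℚ :+ con 1ℚ := N) refl N) ⟩
    (N - I) * binom N i * Q
      ≡⟨ solve 3 (λ a b c → a :* b :* c := a :* (b :* c)) refl (N - I) (binom N i) Q ⟩
    (N - I) * kernel n ∎
    where
    N C[n-1] Q : ℚ
    N = ℕ→ℚ n
    C[n-1] = binom (N - 1ℚ) i
    Q = binom (ℕ→ℚ (n +ℕ j)) j

  -- G(n+1) = (n+1+j) c(n), by absorption in the upper argument n+j of C(n+j,j).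
  antidiff-suc : ∀ n → antidiff (suc n) ≡ (ℕ→ℚ n + 1ℚ + J) * kernel n
  antidiff-suc n = begin
    ℕ→ℚ (suc n) * binom (ℕ→ℚ (suc n) - 1ℚ) i * binom (ℕ→ℚ (suc (n +ℕ j))) j
      ≡⟨ cong₃ (λ u v w → u * binom v i * binom w j) (ℕ→ℚ-suc n) [n+1]-1≡n [n+j+1]≡ ⟩
    (1ℚ + N) * P * binom (Y + 1ℚ) j
      ≡⟨ solve 4 (λ N J P b → (con 1ℚ :+ N) :* P :* b := P :* ((N :+ J :+ con 1ℚ :- J) :* b))
           refl N J P (binom (Y + 1ℚ) j) ⟩
    P * ((Y + 1ℚ - J) * binom (Y + 1ℚ) j)
      ≡⟨ cong (P *_) (sym (binom-absorb Y j)) ⟩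
    P * ((Y + 1ℚ) * binom Y j)
      ≡⟨ solve 4 (λ N J P b → P :* ((N :+ J :+ con 1ℚ) :* b) := (N :+ con 1ℚ :+ J) :* (P :* b))
           refl N J P (binom Y j) ⟩
    (N + 1ℚ + J) * (P * binom Y j)
      ≡⟨ cong (λ t → (N + 1ℚ + J) * (P * binom t j)) (sym (ℕ→ℚ-+ n j)) ⟩
    (N + 1ℚ + J) * kernel n ∎
    where
    N P Y : ℚ
    N = ℕ→ℚ n
    P = binom N i
    Y = N + J
    cong₃ : ∀ (f : ℚ → ℚ → ℚ → ℚ) {a b c a' b' c'} → a ≡ a' → b ≡ b' → c ≡ c' → f a b c ≡ f a' b' c'
    cong₃ f refl refl refl = refl
    [n+1]-1≡n : ℕ→ℚ (suc n) - 1ℚ ≡ N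
    [n+1]-1≡n = trans (cong (_- 1ℚ) (ℕ→ℚ-suc n)) (solve 1 (λ N → con 1ℚ :+ N :- con 1ℚ := N) refl N)
    [n+j+1]≡ : ℕ→ℚ (suc (n +ℕ j)) ≡ Y + 1ℚ
    [n+j+1]≡ = trans (ℕ→ℚ-suc (n +ℕ j)) (trans (cong (λ t → 1ℚ + t) (ℕ→ℚ-+ n j))
                 (solve 2 (λ N J → con 1ℚ :+ (N :+ J) := N :+ J :+ con 1ℚ) refl N J))

  Σ-kernel : ∀ n → Σ< n kernel * ℕ→ℚ (suc (i +ℕ j)) ≡ antidiff n
  Σ-kernel zero = solve 3 (λ N b Q → con 0ℚ :* N := con 0ℚ :* b :* Q)
    refl (ℕ→ℚ (suc (i +ℕ j))) (binom (0ℚ - 1ℚ) i) (binom (ℕ→ℚ j) j)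
  Σ-kernel (suc n) = begin
    (Σ< n kernel + kernel n) * ℕ→ℚ (suc (i +ℕ j))
      ≡⟨ *-distribʳ-+ _ (Σ< n kernel) (kernel n) ⟩
    Σ< n kernel * ℕ→ℚ (suc (i +ℕ j)) + kernel n * ℕ→ℚ (suc (i +ℕ j))
      ≡⟨ cong₂ _+_ (trans (Σ-kernel n) (antidiff≡ n)) (cong (kernel n *_) [i+j+1]≡) ⟩
    (N - I) * kernel n + kernel n * (1ℚ + (I + J))
      ≡⟨ solve 4 (λ N I J c → (N :- I) :* c :+ c :* (con 1ℚ :+ (I :+ J)) := (N :+ con 1ℚ :+ J) :* c)
           refl N I J (kernel n) ⟩
    (N + 1ℚ + J) * kernel n
      ≡⟨ sym (antidiff-suc n) ⟩
    antidiff (suc n) ∎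
    where
    N : ℚ
    N = ℕ→ℚ n

  Σ-odd-kernel : ∀ n → Σ< n (λ k → odd k * kernel k) * (ℕ→ℚ (suc (i +ℕ j)) * ℕ→ℚ (suc (suc (i +ℕ j))))
                     ≡ antidiff n * linear n
  Σ-odd-kernel zero = solve 4 (λ a b c d → con 0ℚ :* a := con 0ℚ :* b :* c :* d)
    refl (ℕ→ℚ (suc (i +ℕ j)) * ℕ→ℚ (suc (suc (i +ℕ j)))) (binom (0ℚ - 1ℚ) i) (binom (ℕ→ℚ j) j) (linear 0)
  Σ-odd-kernel (suc n) = begin
    (Σ< n (λ k → odd k * kernel k) + odd n * kernel n) * M
      ≡⟨ *-distribʳ-+ M (Σ< n (λ k → odd k * kernel k)) (odd n * kernel n) ⟩
    Σ< n (λ k → odd k * kernel k) * M + odd n * kernel n * M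
      ≡⟨ cong (_+ odd n * kernel n * M) (Σ-odd-kernel n) ⟩
    antidiff n * linear n + odd n * kernel n * M
      ≡⟨ cong₂ _+_ (cong₂ _*_ (antidiff≡ n) (linear≡ n))
                   (cong₂ (λ u v → u * kernel n * v) (odd≡ n) (cong₂ _*_ [i+j+1]≡ [i+j+2]≡)) ⟩
    (N - I) * kernel n * ((N + N) * (1ℚ + (I + J)) + (I - J))
      + (N + N + 1ℚ) * kernel n * ((1ℚ + (I + J)) * (1ℚ + (1ℚ + (I + J))))
      ≡⟨ solve 4 (λ N I J c →
             (N :- I) :* c :* ((N :+ N) :* (con 1ℚ :+ (I :+ J)) :+ (I :- J))
               :+ (N :+ N :+ con 1ℚ) :* c :* ((con 1ℚ :+ (I :+ J)) :* (con 1ℚ :+ (con 1ℚ :+ (I :+ J))))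
           := (N :+ con 1ℚ :+ J) :* c :* (((con 1ℚ :+ N) :+ (con 1ℚ :+ N)) :* (con 1ℚ :+ (I :+ J)) :+ (I :- J)))
           refl N I J (kernel n) ⟩
    (N + 1ℚ + J) * kernel n * (((1ℚ + N) + (1ℚ + N)) * (1ℚ + (I + J)) + (I - J))
      ≡⟨ cong₂ _*_ (sym (antidiff-suc n))
                   (trans (cong (λ t → (t + t) * (1ℚ + (I + J)) + (I - J)) (sym (ℕ→ℚ-suc n)))
                          (sym (linear≡ (suc n)))) ⟩
    antidiff (suc n) * linear (suc n) ∎
    where
    N M : ℚ
    N = ℕ→ℚ n
    M = ℕ→ℚ (suc (i +ℕ j)) * ℕ→ℚ (suc (suc (i +ℕ j)))

  Σ-kernel-closed : ∀ n → Σ< n kernel ≡ antidiff n * recip (i +ℕ j)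
  Σ-kernel-closed n = divide (Σ-kernel n) (recip-inverse (i +ℕ j))

  Σ-odd-kernel-closed : ∀ n → Σ< n (λ k → odd k * kernel k)
                            ≡ antidiff n * linear n * (recip (i +ℕ j) * recip (suc (i +ℕ j)))
  Σ-odd-kernel-closed n = divide (Σ-odd-kernel n) inverse
    where
    inverse : (ℕ→ℚ (suc (i +ℕ j)) * ℕ→ℚ (suc (suc (i +ℕ j)))) * (recip (i +ℕ j) * recip (suc (i +ℕ j))) ≡ 1ℚ
    inverse = trans (solve 4 (λ a b c d → (a :* b) :* (c :* d) := (a :* c) :* (b :* d))
                       refl (ℕ→ℚ (suc (i +ℕ j))) (ℕ→ℚ (suc (suc (i +ℕ j)))) (recip (i +ℕ j)) (recip (suc (i +ℕ j))))
                    (cong₂ _*_ (recip-inverse (i +ℕ j)) (recip-inverse (suc (i +ℕ j))))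

  linear-split : ∀ n → linear n * (recip (i +ℕ j) * recip (suc (i +ℕ j)))
                     ≡ + (2 *ℕ n) / suc (suc (i +ℕ j)) + (I - J) * (+ 1 / (suc (i +ℕ j) *ℕ suc (suc (i +ℕ j))))
  linear-split n = begin
    (D * N₁ + K) * (r₁ * r₂)      ≡⟨ solve 5 (λ D N₁ K r₁ r₂ → (D :* N₁ :+ K) :* (r₁ :* r₂) := D :* r₂ :* (N₁ :* r₁) :+ K :* (r₁ :* r₂))
                                       refl D N₁ K r₁ r₂ ⟩
    D * r₂ * (N₁ * r₁) + K * (r₁ * r₂) ≡⟨ cong (λ t → D * r₂ * t + K * (r₁ * r₂)) (recip-inverse (i +ℕ j)) ⟩
    D * r₂ * 1ℚ + K * (r₁ * r₂)   ≡⟨ cong (_+ K * (r₁ * r₂)) (*-identityʳ (D * r₂)) ⟩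
    D * r₂ + K * (r₁ * r₂)        ≡⟨ sym (cong₂ (λ u v → u + K * v) (/suc≡*recip (2 *ℕ n) (suc (i +ℕ j))) (recip-* (i +ℕ j) (suc (i +ℕ j)))) ⟩
    + (2 *ℕ n) / suc (suc (i +ℕ j)) + K * (+ 1 / (suc (i +ℕ j) *ℕ suc (suc (i +ℕ j)))) ∎
    where
    D N₁ K r₁ r₂ : ℚ
    D  = ℕ→ℚ (2 *ℕ n)
    N₁ = ℕ→ℚ (suc (i +ℕ j))
    K  = I - J
    r₁ = recip (i +ℕ j)
    r₂ = recip (suc (i +ℕ j))

open KSum using (kernel; antidiff; Σ-kernel-closed; Σ-odd-kernel-closed; linear-split)

module Expansion (x : ℚ) where

  sSummand : ℕ → ℕ → ℚ
  sSummand k i = binom (ℕ→ℚ k) i * binom x i * binom (x + ℕ→ℚ i) i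

  innerSummand : ℕ → ℕ → ℚ
  innerSummand k j = binom x j * binom (-[1+ 0 ] / 1 - x) j * binom (ℕ→ℚ (k +ℕ j)) j

  coef : ℕ → ℕ → ℚ
  coef i j = binom x i * binom (x + ℕ→ℚ i) i * (binom x j * binom (-[1+ 0 ] / 1 - x) j)

  -- For k < n the sum defining s_k(x) may run up to n, as C(k,i) = 0 for i > k.
  s-extend : ∀ n k → k < n → s k x ≡ Σ< n (sSummand k)
  s-extend n k k<n = sym (begin
    Σ< n (sSummand k)                  ≡⟨ cong (λ t → Σ< t (sSummand k)) (sym (ℕ.m∸n+n≡m k<n)) ⟩
    Σ< (n ∸ suc k +ℕ suc k) (sSummand k) ≡⟨ Σ-extend (suc k) (n ∸ suc k) (sSummand k) vanish ⟩
    s k x                              ∎)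
    where
    vanish : ∀ e → sSummand k (e +ℕ suc k) ≡ 0ℚ
    vanish e = trans (cong (λ t → t * binom x (e +ℕ suc k) * binom (x + ℕ→ℚ (e +ℕ suc k)) (e +ℕ suc k))
                           (binom-vanish k e))
                     (solve 2 (λ a b → con 0ℚ :* a :* b := con 0ℚ) refl
                        (binom x (e +ℕ suc k)) (binom (x + ℕ→ℚ (e +ℕ suc k)) (e +ℕ suc k)))

  expand : ∀ n (w : ℕ → ℚ) → Σ< n (λ k → w k * s k x * inner n x k)
                           ≡ Σ< n (λ i → Σ< n (λ j → coef i j * Σ< n (λ k → w k * kernel i j k)))
  expand n w = begin
    Σ< n (λ k → w k * s k x * inner n x k)
      ≡⟨ Σ-cong< n (λ k k<n → cong (λ t → w k * t * inner n x k) (s-extend n k k<n)) ⟩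
    Σ< n (λ k → w k * Σ< n (sSummand k) * inner n x k)
      ≡⟨ Σ-cong n (λ k → trans (cong (_* inner n x k) (Σ-*ˡ n (w k) (sSummand k)))
                               (Σ-product n n (λ i → w k * sSummand k i) (innerSummand k))) ⟩
    Σ< n (λ k → Σ< n (λ i → Σ< n (λ j → w k * sSummand k i * innerSummand k j)))
      ≡⟨ Σ-swap n n (λ k i → Σ< n (λ j → w k * sSummand k i * innerSummand k j)) ⟩
    Σ< n (λ i → Σ< n (λ k → Σ< n (λ j → w k * sSummand k i * innerSummand k j)))
      ≡⟨ Σ-cong n (λ i → Σ-swap n n (λ k j → w k * sSummand k i * innerSummand k j)) ⟩
    Σ< n (λ i → Σ< n (λ j → Σ< n (λ k → w k * sSummand k i * innerSummand k j)))
      ≡⟨ Σ-cong n (λ i → Σ-cong n (λ j → trans (Σ-cong n (regroup i j))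
                                                (sym (Σ-*ˡ n (coef i j) (λ k → w k * kernel i j k))))) ⟩
    Σ< n (λ i → Σ< n (λ j → coef i j * Σ< n (λ k → w k * kernel i j k))) ∎
    where
    regroup : ∀ i j k → w k * sSummand k i * innerSummand k j ≡ coef i j * (w k * kernel i j k)
    regroup i j k = solve 7 (λ w a b c d e f → w :* (a :* b :* c) :* (d :* e :* f) := b :* c :* (d :* e) :* (w :* (a :* f)))
      refl (w k) (binom (ℕ→ℚ k) i) (binom x i) (binom (x + ℕ→ℚ i) i)
           (binom x j) (binom (-[1+ 0 ] / 1 - x) j) (binom (ℕ→ℚ (k +ℕ j)) j)

  -- coef(i,j) · G(n) = n · common(n,x,i,j): reflection trades C(-1-x,j) C(n+j,j)
  -- for C(x+j,j) C(-n-1,j).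
  coef-antidiff : ∀ n i j → coef i j * antidiff i j n ≡ ℕ→ℚ n * common n x i j
  coef-antidiff n i j = begin
    A * (bxj * binom (- 1ℚ - x) j) * (N * P * binom (ℕ→ℚ (n +ℕ j)) j)
      ≡⟨ cong (λ t → A * (bxj * binom (- 1ℚ - x) j) * (N * P * binom t j)) (ℕ→ℚ-+ n j) ⟩
    A * (bxj * binom (- 1ℚ - x) j) * (N * P * binom (N + ℕ→ℚ j) j)
      ≡⟨ solve 6 (λ A b P N R Z → A :* (b :* R) :* (N :* P :* Z) := N :* (A :* b :* P) :* (R :* Z))
           refl A bxj P N (binom (- 1ℚ - x) j) (binom (N + ℕ→ℚ j) j) ⟩
    N * (A * bxj * P) * (binom (- 1ℚ - x) j * binom (N + ℕ→ℚ j) j)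
      ≡⟨ cong (N * (A * bxj * P) *_) (binom-reflect-swap x N j) ⟩
    N * (A * bxj * P) * (binom (x + ℕ→ℚ j) j * binom (- 1ℚ - N) j)
      ≡⟨ cong (λ t → N * (A * bxj * P) * (binom (x + ℕ→ℚ j) j * binom t j)) (sym (ℕ→ℚ-negsuc n)) ⟩
    N * (A * bxj * P) * (binom (x + ℕ→ℚ j) j * binom (-[1+ n ] / 1) j)
      ≡⟨ solve 6 (λ N A b P Y Z → N :* (A :* b :* P) :* (Y :* Z) := N :* (A :* b :* Y :* P :* Z))
           refl N A bxj P (binom (x + ℕ→ℚ j) j) (binom (-[1+ n ] / 1) j) ⟩
    N * common n x i j ∎
    where
    A bxj N P : ℚ
    A   = binom x i * binom (x + ℕ→ℚ i) i
    bxj = binom x j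
    N   = ℕ→ℚ n
    P   = binom (N - 1ℚ) i

  term : ∀ n i j → coef i j * Σ< n (kernel i j) ≡ common n x i j * (+ n / suc (i +ℕ j))
  term n i j = begin
    coef i j * Σ< n (kernel i j)                 ≡⟨ cong (coef i j *_) (Σ-kernel-closed i j n) ⟩
    coef i j * (antidiff i j n * recip (i +ℕ j)) ≡⟨ sym (*-assoc (coef i j) (antidiff i j n) (recip (i +ℕ j))) ⟩
    coef i j * antidiff i j n * recip (i +ℕ j)   ≡⟨ cong (_* recip (i +ℕ j)) (coef-antidiff n i j) ⟩
    ℕ→ℚ n * common n x i j * recip (i +ℕ j)      ≡⟨ solve 3 (λ N c r → N :* c :* r := c :* (N :* r))
                                                      refl (ℕ→ℚ n) (common n x i j) (recip (i +ℕ j)) ⟩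
    common n x i j * (ℕ→ℚ n * recip (i +ℕ j))    ≡⟨ cong (common n x i j *_) (sym (/suc≡*recip n (i +ℕ j))) ⟩
    common n x i j * (+ n / suc (i +ℕ j))        ∎

  odd-term : ∀ m i j → recip m * (coef i j * Σ< (suc m) (λ k → odd k * kernel i j k))
    ≡ common (suc m) x i j * ((+ (2 *ℕ suc m) / suc (suc (i +ℕ j)))
                              + (ℕ→ℚ i - ℕ→ℚ j) * (+ 1 / (suc (i +ℕ j) *ℕ suc (suc (i +ℕ j)))))
  odd-term m i j = begin
    recip m * (coef i j * Σ< (suc m) (λ k → odd k * kernel i j k))
      ≡⟨ cong (λ t → recip m * (coef i j * t)) (Σ-odd-kernel-closed i j (suc m)) ⟩
    recip m * (coef i j * (antidiff i j (suc m) * L * R))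
      ≡⟨ solve 5 (λ r c G L R → r :* (c :* (G :* L :* R)) := r :* (c :* G) :* (L :* R))
           refl (recip m) (coef i j) (antidiff i j (suc m)) L R ⟩
    recip m * (coef i j * antidiff i j (suc m)) * (L * R)
      ≡⟨ cong (λ t → recip m * t * (L * R)) (coef-antidiff (suc m) i j) ⟩
    recip m * (ℕ→ℚ (suc m) * common (suc m) x i j) * (L * R)
      ≡⟨ solve 5 (λ r N c L R → r :* (N :* c) :* (L :* R) := N :* r :* (c :* (L :* R)))
           refl (recip m) (ℕ→ℚ (suc m)) (common (suc m) x i j) L R ⟩
    ℕ→ℚ (suc m) * recip m * (common (suc m) x i j * (L * R))
      ≡⟨ trans (cong (_* (common (suc m) x i j * (L * R))) (recip-inverse m)) (*-identityˡ _) ⟩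
    common (suc m) x i j * (L * R)
      ≡⟨ cong (common (suc m) x i j *_) (linear-split i j (suc m)) ⟩
    common (suc m) x i j * ((+ (2 *ℕ suc m) / suc (suc (i +ℕ j)))
                            + (ℕ→ℚ i - ℕ→ℚ j) * (+ 1 / (suc (i +ℕ j) *ℕ suc (suc (i +ℕ j))))) ∎
    where
    L R : ℚ
    L = KSum.linear i j (suc m)
    R = recip (i +ℕ j) * recip (suc (i +ℕ j))

open Expansion using (expand; term; odd-term)

identity₁ : ∀ n x → Σ< n (λ k → s k x * inner n x k)
                  ≡ Σ< n (λ i → Σ< n (λ j → common n x i j * (+ n / suc (i +ℕ j))))
identity₁ n x = begin
  Σ< n (λ k → s k x * inner n x k)
    ≡⟨ Σ-cong n (λ k → cong (_* inner n x k) (sym (*-identityˡ (s k x)))) ⟩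
  Σ< n (λ k → 1ℚ * s k x * inner n x k)
    ≡⟨ expand x n (λ _ → 1ℚ) ⟩
  Σ< n (λ i → Σ< n (λ j → Expansion.coef x i j * Σ< n (λ k → 1ℚ * kernel i j k)))
    ≡⟨ Σ-cong n (λ i → Σ-cong n (λ j → trans (cong (Expansion.coef x i j *_) (Σ-cong n (λ k → *-identityˡ (kernel i j k))))
                                             (term x n i j))) ⟩
  Σ< n (λ i → Σ< n (λ j → common n x i j * (+ n / suc (i +ℕ j)))) ∎

identity₂ : ∀ m x → recip m * Σ< (suc m) (λ k → odd k * s k x * inner (suc m) x k)
  ≡ Σ< (suc m) (λ i → Σ< (suc m) (λ j → common (suc m) x i j
      * ((+ (2 *ℕ suc m) / suc (suc (i +ℕ j)))
         + (ℕ→ℚ i - ℕ→ℚ j) * (+ 1 / (suc (i +ℕ j) *ℕ suc (suc (i +ℕ j)))))))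
identity₂ m x = begin
  recip m * Σ< n (λ k → odd k * s k x * inner n x k)
    ≡⟨ cong (recip m *_) (expand x n odd) ⟩
  recip m * Σ< n (λ i → Σ< n (λ j → Expansion.coef x i j * Σ< n (λ k → odd k * kernel i j k)))
    ≡⟨ Σ-*ˡ n (recip m) _ ⟩
  Σ< n (λ i → recip m * Σ< n (λ j → Expansion.coef x i j * Σ< n (λ k → odd k * kernel i j k)))
    ≡⟨ Σ-cong n (λ i → trans (Σ-*ˡ n (recip m) _) (Σ-cong n (odd-term x m i))) ⟩
  Σ< n (λ i → Σ< n (λ j → common n x i j
      * ((+ (2 *ℕ n) / suc (suc (i +ℕ j))) + (ℕ→ℚ i - ℕ→ℚ j) * (+ 1 / (suc (i +ℕ j) *ℕ suc (suc (i +ℕ j))))))) ∎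
  where
  n : ℕ
  n = suc m

lemma4p2 : (n : ℕ) → .{{_ : NonZero n}} → (x : ℚ) →
    (Σ< n (λ k → s k x * inner n x k)
      ≡ Σ< n (λ i → Σ< n (λ j → common n x i j * (+ n / suc (i +ℕ j)))))
    ×
    ((+ 1 / n) * Σ< n (λ k → (ℕ→ℚ (2 *ℕ k +ℕ 1)) * s k x * inner n x k)
      ≡ Σ< n (λ i → Σ< n (λ j → common n x i j
          * ((+ (2 *ℕ n) / suc (suc (i +ℕ j)))
             + (ℕ→ℚ i - ℕ→ℚ j) * (+ 1 / (suc (i +ℕ j) *ℕ suc (suc (i +ℕ j))))))))
lemma4p2 (suc m) x = identity₁ (suc m) x , identity₂ m x
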